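{- Let $(K,v)$ be a henselian nontrivially valued field of characteristic exponent $p$, and let $C\subseteq K$ be a subfield such that $K/C$ is separable. Let $(a,\mathbf{b}),(c,\mathbf{d})\in K^{1+n}$. Then $(c,\mathbf{d})\in\mathrm{locus}(a,\mathbf{b}/C)$ if and only if $(c^{p},\mathbf{d})\in\mathrm{locus}(a^{p},\mathbf{b}/C)$.
   Context: For $\mathbf{e}\in K^{k}$, $\mathrm{locus}(\mathbf{e}/C)=\{\mathbf{e}'\in K^{k}\mid \forall f\in C[X_1,\dots,X_k]\,(f(\mathbf{e})=0\Rightarrow f(\mathbf{e}')=0)\}$. The characteristic exponent $p$ is the characteristic if positive and $1$ otherwise. -}

module Defs where

open import Level using (Level; _⊔_; suc)
open import Data.Nat as ℕ using (ℕ; zero) renaming (suc to 1+)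
open import Data.Nat.Primality using (Prime)
open import Data.Fin using (Fin)
import Data.Unit
open import Data.List using (List; []; _∷_; _++_; [_])
open import Data.Maybe using (Maybe; just; nothing)
open import Data.Product using (Σ; _×_; _,_; ∃)
open import Data.Sum using (_⊎_)
open import Data.Empty using (⊥)
open import Relation.Nullary using (¬_)
open import Relation.Unary using (Pred; _∈_)
open import Relation.Binary.PropositionalEquality using (_≡_)
open import Algebra.Bundles using (CommutativeRing)
open import Data.Vec.Functional using (Vector)

record Field (c ℓ : Level) : Set (suc (c ⊔ ℓ)) where
  field
    commutativeRing : CommutativeRing c ℓ
  open CommutativeRing commutativeRing public
  field
    1≉0     : ¬ (1# ≈ 0#)
    inverse : ∀ x → ¬ (x ≈ 0#) → Σ Carrier (λ y → (x * y) ≈ 1#)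

module FieldOps {c ℓ} (K : Field c ℓ) where
  open Field K

  natMul : ℕ → Carrier → Carrier
  natMul zero   x = 0#
  natMul (1+ n) x = x + natMul n x

  pow : Carrier → ℕ → Carrier
  pow x zero   = 1#
  pow x (1+ n) = x * pow x n

  sumV : ∀ {m} → Vector Carrier m → Carrier
  sumV {zero}  v = 0#
  sumV {1+ m}  v = v Fin.zero + sumV (λ i → v (Fin.suc i))

  -- univariate polynomials over K, coefficient lists (constant term first)
  evalU : List Carrier → Carrier → Carrier
  evalU []       x = 0#
  evalU (a ∷ as) x = a + x * evalU as x

  derivFrom : ℕ → List Carrier → List Carrier
  derivFrom k []       = []
  derivFrom k (a ∷ as) = natMul k a ∷ derivFrom (1+ k) as

  deriv : List Carrier → List Carrier
  deriv []       = []
  deriv (a ∷ as) = derivFrom 1 as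

  monic : List Carrier → List Carrier
  monic as = as ++ [ 1# ]

  data AllIn {q} (P : Pred Carrier q) : List Carrier → Set (c ⊔ q) where
    []  : AllIn P []
    _∷_ : ∀ {a as} → P a → AllIn P as → AllIn P (a ∷ as)

  -- characteristic exponent: p = char K if char K > 0, and p = 1 otherwise
  IsCharExp : ℕ → Set ℓ
  IsCharExp p =
    (p ≡ 1 × (∀ n → ¬ (natMul (1+ n) 1# ≈ 0#)))
    ⊎ (Prime p × (natMul p 1# ≈ 0#))

  record IsSubfield (C : Pred Carrier ℓ) : Set (c ⊔ ℓ) where
    field
      resp  : ∀ {x y} → x ≈ y → x ∈ C → y ∈ C
      0∈    : 0# ∈ C
      1∈    : 1# ∈ C
      +-cl  : ∀ {x y} → x ∈ C → y ∈ C → (x + y) ∈ C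
      *-cl  : ∀ {x y} → x ∈ C → y ∈ C → (x * y) ∈ C
      neg-cl : ∀ {x} → x ∈ C → (- x) ∈ C
      inv-cl : ∀ {x y} → x ∈ C → (x * y) ≈ 1# → y ∈ C

  LinIndepOverPowers : ℕ → Pred Carrier ℓ → ∀ {m} → Vector Carrier m → Set (c ⊔ ℓ)
  LinIndepOverPowers p S {m} cs =
    (λs : Vector Carrier m) → (∀ i → λs i ∈ S) →
    sumV (λ i → pow (λs i) p * cs i) ≈ 0# → ∀ i → λs i ≈ 0#

  Everything : Pred Carrier ℓ
  Everything _ = Level.Lift ℓ Data.Unit.⊤

  -- K/C separable (p = characteristic exponent): K^p and C are linearly
  -- disjoint over C^p (Mac Lane's criterion; equivalently K and C^{1/p}
  -- linearly disjoint over C).  In characteristic 0 (p = 1) it is automatic.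
  Separable : ℕ → Pred Carrier ℓ → Set (c ⊔ ℓ)
  Separable p C = ∀ {m} (cs : Vector Carrier m) → (∀ i → cs i ∈ C) →
    LinIndepOverPowers p C cs → LinIndepOverPowers p Everything cs

  -- multivariate polynomials in k variables (as terms) and evaluation
  data Poly (k : ℕ) : Set c where
    const : Carrier → Poly k
    var   : Fin k → Poly k
    _⊕_   : Poly k → Poly k → Poly k
    _⊗_   : Poly k → Poly k → Poly k

  ⟦_⟧ : ∀ {k} → Poly k → Vector Carrier k → Carrier
  ⟦ const a ⟧ e = a
  ⟦ var i   ⟧ e = e i
  ⟦ f ⊕ g   ⟧ e = ⟦ f ⟧ e + ⟦ g ⟧ e
  ⟦ f ⊗ g   ⟧ e = ⟦ f ⟧ e * ⟦ g ⟧ e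

  data CoeffsIn (C : Pred Carrier ℓ) {k} : Poly k → Set (c ⊔ ℓ) where
    const : ∀ {a} → a ∈ C → CoeffsIn C (const a)
    var   : ∀ {i} → CoeffsIn C (var i)
    _⊕_   : ∀ {f g} → CoeffsIn C f → CoeffsIn C g → CoeffsIn C (f ⊕ g)
    _⊗_   : ∀ {f g} → CoeffsIn C f → CoeffsIn C g → CoeffsIn C (f ⊗ g)

  -- e' ∈ locus(e / C)
  InLocus : ∀ {k} → Vector Carrier k → Vector Carrier k → Pred Carrier ℓ → Set (c ⊔ ℓ)
  InLocus e' e C = ∀ (f : Poly _) → CoeffsIn C f → ⟦ f ⟧ e ≈ 0# → ⟦ f ⟧ e' ≈ 0#

record OrderedAbelianGroup (γ : Level) : Set (suc γ) where
  field
    Γ     : Set γ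
    _⊞_   : Γ → Γ → Γ
    ε     : Γ
    ⊟_    : Γ → Γ
    _≤_   : Γ → Γ → Set γ
    assoc : ∀ x y z → ((x ⊞ y) ⊞ z) ≡ (x ⊞ (y ⊞ z))
    comm  : ∀ x y → (x ⊞ y) ≡ (y ⊞ x)
    idˡ   : ∀ x → (ε ⊞ x) ≡ x
    invˡ  : ∀ x → ((⊟ x) ⊞ x) ≡ ε
    refl≤  : ∀ x → x ≤ x
    trans≤ : ∀ {x y z} → x ≤ y → y ≤ z → x ≤ z
    antisym≤ : ∀ {x y} → x ≤ y → y ≤ x → x ≡ y
    total≤ : ∀ x y → x ≤ y ⊎ y ≤ x
    mono≤  : ∀ {x y} z → x ≤ y → (x ⊞ z) ≤ (y ⊞ z)

module _ {γ} (G : OrderedAbelianGroup γ) where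
  open OrderedAbelianGroup G

  -- Γ ∪ {∞}, with ∞ = nothing
  _⊞∞_ : Maybe Γ → Maybe Γ → Maybe Γ
  just x ⊞∞ just y = just (x ⊞ y)
  _      ⊞∞ _      = nothing

  _≤∞_ : Maybe Γ → Maybe Γ → Set γ
  _      ≤∞ nothing = Level.Lift γ Data.Unit.⊤
  nothing ≤∞ just y = Level.Lift γ ⊥
  just x  ≤∞ just y = x ≤ y

  _<∞_ : Maybe Γ → Maybe Γ → Set γ
  x <∞ y = (x ≤∞ y) × ¬ (x ≡ y)

record Valuation {c ℓ} (K : Field c ℓ) (γ : Level) : Set (c ⊔ ℓ ⊔ suc γ) where
  open Field K
  field
    group : OrderedAbelianGroup γ
  open OrderedAbelianGroup group public
  field
    v       : Carrier → Maybe Γ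
    v-resp  : ∀ {x y} → x ≈ y → v x ≡ v y
    v-∞     : ∀ x → (v x ≡ nothing → x ≈ 0#) × (x ≈ 0# → v x ≡ nothing)
    v-mul   : ∀ x y → v (x * y) ≡ _⊞∞_ group (v x) (v y)
    v-add   : ∀ x y → (_≤∞_ group (v x) (v (x + y)))
                    ⊎ (_≤∞_ group (v y) (v (x + y)))

  ε∞ : Maybe Γ
  ε∞ = just ε

  Integral : Carrier → Set γ
  Integral x = _≤∞_ group ε∞ (v x)

module ValuationProps {c ℓ γ} {K : Field c ℓ} (val : Valuation K γ) where
  open Field K
  open FieldOps K
  open Valuation val

  Nontrivial : Set (c ⊔ γ)
  Nontrivial = ∃ λ x → ¬ (v x ≡ nothing) × ¬ (v x ≡ ε∞)

  Henselian : Set (c ⊔ ℓ ⊔ γ)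
  Henselian = ∀ (as : List Carrier) → AllIn Integral as →
    ∀ a → Integral a →
    _<∞_ group ε∞ (v (evalU (monic as) a)) →
    v (evalU (deriv (monic as)) a) ≡ ε∞ →
    Σ Carrier λ b → Integral b × (evalU (monic as) b ≈ 0#)
                  × _<∞_ group ε∞ (v (b - a))

module Submission where

-- Write Fr(x) = x^p.  Since p is the characteristic exponent, Fr is a ring
-- endomorphism of K (Frobenius; trivially so when p = 1), and it is injective at
-- zero because a valued field has decidable equality with zero and no zero
-- divisors.  The proof rests on two general facts about loci over C:
--
--  * `locus-map`: a polynomial map σ with coefficients in C preserves loci:
--    e' ∈ locus(e/C) implies σ(e') ∈ locus(σ(e)/C).  Applied to
--    σ(x, y) = (x^p, y) it gives "⇒".
--  * `locus-reflect`: for a ring endomorphism φ that is injective at zero and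
--    maps C into C, φ(e') ∈ locus(φ(e)/C) implies e' ∈ locus(e/C); indeed
--    f(e) = 0 gives f^φ(φ(e)) = φ(f(e)) = 0, where f^φ applies φ to the
--    coefficients.  For "⇐" apply `locus-map` with σ(x, y) = (x, y^p), which
--    sends (a^p, b) to (Fr a, Fr b), and then `locus-reflect` with φ = Fr.

open import Defs
open import Level using (Level)
open import Data.Nat as ℕ using (ℕ; suc)
open import Algebra.Bundles using (Monoid; CommutativeRing)
open import Data.Vec.Functional using (Vector; _∷_)
open import Relation.Unary using (Pred)
open import Function.Bundles using (_⇔_)

module PrimeBinomial where
  open import Data.Nat
  open import Data.Nat.Properties using (m≤n⇒m≤1+n; <⇒≤; <⇒≱; ∸-monoʳ-<; _!*_!≢0)
  open import Data.Nat.Divisibility using (_∣_; ∣1⇒≡1; ∣⇒≤; m∣m*n)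
  open import Data.Nat.DivMod using (m/n*n≡m)
  open import Data.Nat.Primality using (Prime; prime; euclidsLemma; prime⇒nonZero)
  open import Data.Nat.Combinatorics using (_C_; nCk≡n!/k![n-k]!; k![n∸k]!∣n!)
  open import Data.Sum using (inj₁; inj₂)
  open import Relation.Nullary using (contradiction)
  open import Relation.Binary.PropositionalEquality using (_≡_; cong; trans; sym; subst)

  -- A prime dividing m! divides one of the factors 1, …, m, so it is at most m.
  prime∣factorial⇒≤ : ∀ {p} → Prime p → ∀ m → p ∣ m ! → p ≤ m
  prime∣factorial⇒≤ (prime _) zero p∣1 = contradiction (∣1⇒≡1 p∣1) nonTrivial⇒≢1
  prime∣factorial⇒≤ pp (suc m) p∣m! with euclidsLemma (suc m) (m !) pp p∣m!
  ... | inj₁ p∣1+m = ∣⇒≤ p∣1+m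
  ... | inj₂ p∣m!′ = m≤n⇒m≤1+n (prime∣factorial⇒≤ pp m p∣m!′)

  -- p ∣ C(p,k) for 0 < k < p: p divides p! = C(p,k) · k! · (p-k)!, but
  -- neither k! nor (p-k)! since both k and p-k are below p.
  prime∣choose : ∀ {p k} → Prime p → 0 < k → k < p → p ∣ p C k
  prime∣choose {p} {k} pp 0<k k<p
    with euclidsLemma (p C k) (k ! * (p ∸ k) !) pp p∣product
    where
    instance
      k![p-k]!≢0 : NonZero (k ! * (p ∸ k) !)
      k![p-k]!≢0 = k !* (p ∸ k) !≢0
    factorisation : (p C k) * (k ! * (p ∸ k) !) ≡ p !
    factorisation = trans (cong (_* (k ! * (p ∸ k) !)) (nCk≡n!/k![n-k]! (<⇒≤ k<p)))
                          (m/n*n≡m (k![n∸k]!∣n! (<⇒≤ k<p)))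
    n∣n! : ∀ n → .{{NonZero n}} → n ∣ n !
    n∣n! (suc n) = m∣m*n (n !)
    p∣product : p ∣ (p C k) * (k ! * (p ∸ k) !)
    p∣product = subst (p ∣_) (sym factorisation) (n∣n! p {{prime⇒nonZero pp}})
  ... | inj₁ p∣pCk = p∣pCk
  ... | inj₂ p∣k![p-k]! with euclidsLemma (k !) ((p ∸ k) !) pp p∣k![p-k]!
  ... | inj₁ p∣k! = contradiction (prime∣factorial⇒≤ pp k p∣k!) (<⇒≱ k<p)
  ... | inj₂ p∣[p-k]! =
    contradiction (prime∣factorial⇒≤ pp (p ∸ k) p∣[p-k]!) (<⇒≱ (∸-monoʳ-< 0<k (<⇒≤ k<p)))

module SumOfLastTerm {c ℓ} (M : Monoid c ℓ) where
  open Monoid M renaming (_∙_ to _+_; ε to 0#)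
  open import Algebra.Properties.Monoid.Sum M using (sum)
  open import Data.Nat using (_<_; s≤s; z≤n)
  open import Data.Fin using (zero; suc; toℕ; fromℕ)
  open import Relation.Binary.Reasoning.Setoid setoid

  sum-last : ∀ m (t : Vector Carrier (suc m)) →
    (∀ i → toℕ i < m → t i ≈ 0#) → sum t ≈ t (fromℕ m)
  sum-last ℕ.zero t _ = identityʳ (t zero)
  sum-last (suc m) t vanish = begin
    t zero + sum (λ i → t (suc i))  ≈⟨ ∙-cong (vanish zero (s≤s z≤n)) tail-sum ⟩
    0# + t (fromℕ (suc m))          ≈⟨ identityˡ _ ⟩
    t (fromℕ (suc m))               ∎
    where tail-sum = sum-last m (λ i → t (suc i)) (λ i i<m → vanish (suc i) (s≤s i<m))

module Frobenius {c ℓ} (R : CommutativeRing c ℓ) where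
  open CommutativeRing R hiding (zero)
  open import Algebra.Properties.Semiring.Exp semiring using (_^_)
  open import Algebra.Properties.Semiring.Mult semiring using (_×_; ×-assoc-*; ×1-homo-*; ×-congʳ; ×-homo-1)
  open import Algebra.Properties.CommutativeSemiring.Binomial commutativeSemiring using (theorem; binomialTerm)
  open import Algebra.Properties.Monoid.Sum +-monoid using (sum)
  open SumOfLastTerm +-monoid using (sum-last)
  open import Data.Nat using (_<_; _∸_; s≤s; z≤n)
  open import Data.Nat.Divisibility using (_∣_; divides)
  open import Data.Nat.Primality using (Prime)
  open import Data.Nat.Combinatorics using (_C_; nCn≡1; nCk≡nC[n∸k])
  open import Data.Nat.Properties using (n∸n≡0)
  open import Data.Fin using (zero; suc; toℕ; fromℕ)
  open import Data.Fin.Properties using (toℕ-fromℕ)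
  open import Relation.Binary.PropositionalEquality as ≡ using (_≡_)
  open import Relation.Binary.Reasoning.Setoid setoid
  open PrimeBinomial using (prime∣choose)

  multiple-of-char-vanishes : ∀ {p n} → p × 1# ≈ 0# → p ∣ n → ∀ z → n × z ≈ 0#
  multiple-of-char-vanishes {p} p1≈0 (divides m ≡.refl) z = begin
    (m ℕ.* p) × z              ≈⟨ ×-congʳ (m ℕ.* p) (sym (*-identityˡ z)) ⟩
    (m ℕ.* p) × (1# * z)       ≈⟨ ×-assoc-* (m ℕ.* p) 1# z ⟨
    ((m ℕ.* p) × 1#) * z       ≈⟨ *-congʳ (×1-homo-* m p) ⟩
    ((m × 1#) * (p × 1#)) * z  ≈⟨ *-congʳ (*-congˡ p1≈0) ⟩
    ((m × 1#) * 0#) * z        ≈⟨ *-congʳ (zeroʳ _) ⟩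
    0# * z                     ≈⟨ zeroˡ z ⟩
    0#                         ∎

  coefficient-one : ∀ {n} → n ≡ 1 → ∀ z → n × z ≈ z
  coefficient-one ≡.refl = ×-homo-1

  last-term : ∀ n x y → binomialTerm x y n (fromℕ n) ≈ x ^ n
  last-term n x y rewrite toℕ-fromℕ n = begin
    (n C n) × (x ^ n * y ^ (n ∸ n))  ≈⟨ coefficient-one (nCn≡1 n) _ ⟩
    x ^ n * y ^ (n ∸ n)              ≈⟨ *-congˡ (reflexive (≡.cong (y ^_) (n∸n≡0 n))) ⟩
    x ^ n * 1#                       ≈⟨ *-identityʳ _ ⟩
    x ^ n                            ∎

  first-term : ∀ n x y → binomialTerm x y n zero ≈ y ^ n
  first-term n x y = begin
    (n C 0) × (1# * y ^ n)  ≈⟨ coefficient-one (≡.trans (nCk≡nC[n∸k] {0} {n} z≤n) (nCn≡1 n)) _ ⟩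
    1# * y ^ n              ≈⟨ *-identityˡ _ ⟩
    y ^ n                   ∎

  frobenius : ∀ {p} → Prime p → p × 1# ≈ 0# → ∀ x y → (x + y) ^ p ≈ x ^ p + y ^ p
  frobenius {p@(suc q)} pp p1≈0 x y = begin
    (x + y) ^ p                   ≈⟨ theorem p x y ⟩
    t zero + sum (λ i → t (suc i)) ≈⟨ +-congˡ (sum-last q (λ i → t (suc i)) interior-vanishes) ⟩
    t zero + t (fromℕ p)          ≈⟨ +-cong (first-term p x y) (last-term p x y) ⟩
    y ^ p + x ^ p                 ≈⟨ +-comm _ _ ⟩
    x ^ p + y ^ p                 ∎
    where
    t = binomialTerm x y p
    -- the terms with 0 < k < p carry the coefficient C(p,k), a multiple of p
    interior-vanishes : ∀ i → toℕ i < q → t (suc i) ≈ 0#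
    interior-vanishes i i<q =
      multiple-of-char-vanishes p1≈0 (prime∣choose pp (s≤s z≤n) (s≤s i<q)) _

module Loci {c ℓ} (K : Field c ℓ) (C : Pred (Field.Carrier K) ℓ) where
  open Field K
  open FieldOps K hiding (_∷_; [])
  open import Function using (_∘_)
  open import Relation.Unary using (_∈_)
  open import Relation.Binary.Reasoning.Setoid setoid

  ⟦⟧-cong : ∀ {k} (f : Poly k) {e e' : Vector Carrier k} →
    (∀ i → e i ≈ e' i) → ⟦ f ⟧ e ≈ ⟦ f ⟧ e'
  ⟦⟧-cong (const a) e≈e' = refl
  ⟦⟧-cong (var i)   e≈e' = e≈e' i
  ⟦⟧-cong (f ⊕ g)   e≈e' = +-cong (⟦⟧-cong f e≈e') (⟦⟧-cong g e≈e')
  ⟦⟧-cong (f ⊗ g)   e≈e' = *-cong (⟦⟧-cong f e≈e') (⟦⟧-cong g e≈e')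

  InLocus-resp : ∀ {k} {e₁ e₂ e₁' e₂' : Vector Carrier k} →
    (∀ i → e₁ i ≈ e₂ i) → (∀ i → e₁' i ≈ e₂' i) →
    InLocus e₁' e₁ C → InLocus e₂' e₂ C
  InLocus-resp e₁≈e₂ e₁'≈e₂' e₁'∈locus f f∈C[X] fe₂≈0 =
    trans (sym (⟦⟧-cong f e₁'≈e₂'))
          (e₁'∈locus f f∈C[X] (trans (⟦⟧-cong f e₁≈e₂) fe₂≈0))

  PolyMap : ℕ → ℕ → Set c
  PolyMap k m = Vector (Poly k) m

  apply : ∀ {k m} → PolyMap k m → Vector Carrier k → Vector Carrier m
  apply σ e i = ⟦ σ i ⟧ e

  infix 30 _[_]
  _[_] : ∀ {k m} → Poly m → PolyMap k m → Poly k
  const a [ σ ] = const a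
  var i   [ σ ] = σ i
  (f ⊕ g) [ σ ] = f [ σ ] ⊕ g [ σ ]
  (f ⊗ g) [ σ ] = f [ σ ] ⊗ g [ σ ]

  ⟦subst⟧ : ∀ {k m} (f : Poly m) (σ : PolyMap k m) e → ⟦ f [ σ ] ⟧ e ≈ ⟦ f ⟧ (apply σ e)
  ⟦subst⟧ (const a) σ e = refl
  ⟦subst⟧ (var i)   σ e = refl
  ⟦subst⟧ (f ⊕ g)   σ e = +-cong (⟦subst⟧ f σ e) (⟦subst⟧ g σ e)
  ⟦subst⟧ (f ⊗ g)   σ e = *-cong (⟦subst⟧ f σ e) (⟦subst⟧ g σ e)

  subst-coeffs : ∀ {k m} {f : Poly m} {σ : PolyMap k m} →
    CoeffsIn C f → (∀ i → CoeffsIn C (σ i)) → CoeffsIn C (f [ σ ])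
  subst-coeffs (const a∈C) σ∈C[X] = const a∈C
  subst-coeffs {f = var i} var σ∈C[X] = σ∈C[X] i
  subst-coeffs (f∈C[X] ⊕ g∈C[X]) σ∈C[X] = subst-coeffs f∈C[X] σ∈C[X] ⊕ subst-coeffs g∈C[X] σ∈C[X]
  subst-coeffs (f∈C[X] ⊗ g∈C[X]) σ∈C[X] = subst-coeffs f∈C[X] σ∈C[X] ⊗ subst-coeffs g∈C[X] σ∈C[X]

  locus-map : ∀ {k m} (σ : PolyMap k m) → (∀ i → CoeffsIn C (σ i)) →
    ∀ {e e'} → InLocus e' e C → InLocus (apply σ e') (apply σ e) C
  locus-map σ σ∈C[X] {e} {e'} e'∈locus f f∈C[X] fσe≈0 = begin
    ⟦ f ⟧ (apply σ e')  ≈⟨ ⟦subst⟧ f σ e' ⟨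
    ⟦ f [ σ ] ⟧ e'      ≈⟨ e'∈locus (f [ σ ]) (subst-coeffs f∈C[X] σ∈C[X]) (trans (⟦subst⟧ f σ e) fσe≈0) ⟩
    0#                  ∎

  powP : ∀ {k} → Poly k → ℕ → Poly k
  powP f ℕ.zero  = const 1#
  powP f (suc m) = f ⊗ powP f m

  ⟦powP⟧ : ∀ {k} (f : Poly k) m e → ⟦ powP f m ⟧ e ≈ pow (⟦ f ⟧ e) m
  ⟦powP⟧ f ℕ.zero  e = refl
  ⟦powP⟧ f (suc m) e = *-congˡ (⟦powP⟧ f m e)

  powP-coeffs : ∀ {k} {f : Poly k} → 1# ∈ C → ∀ m → CoeffsIn C f → CoeffsIn C (powP f m)
  powP-coeffs 1∈C ℕ.zero  f∈C[X] = const 1∈C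
  powP-coeffs 1∈C (suc m) f∈C[X] = f∈C[X] ⊗ powP-coeffs 1∈C m f∈C[X]

  module Twist (φ : Carrier → Carrier)
               (φ-cong : ∀ {x y} → x ≈ y → φ x ≈ φ y)
               (φ-+ : ∀ x y → φ (x + y) ≈ φ x + φ y)
               (φ-* : ∀ x y → φ (x * y) ≈ φ x * φ y) where
    open import Algebra.Properties.Group +-group using (identityʳ-unique)

    φ-0 : φ 0# ≈ 0#
    φ-0 = identityʳ-unique (φ 0#) (φ 0#) (sym (trans (φ-cong (sym (+-identityʳ 0#))) (φ-+ 0# 0#)))

    twist : ∀ {k} → Poly k → Poly k
    twist (const a) = const (φ a)
    twist (var i)   = var i
    twist (f ⊕ g)   = twist f ⊕ twist g
    twist (f ⊗ g)   = twist f ⊗ twist g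

    ⟦twist⟧ : ∀ {k} (f : Poly k) e → ⟦ twist f ⟧ (φ ∘ e) ≈ φ (⟦ f ⟧ e)
    ⟦twist⟧ (const a) e = refl
    ⟦twist⟧ (var i)   e = refl
    ⟦twist⟧ (f ⊕ g)   e = trans (+-cong (⟦twist⟧ f e) (⟦twist⟧ g e)) (sym (φ-+ _ _))
    ⟦twist⟧ (f ⊗ g)   e = trans (*-cong (⟦twist⟧ f e) (⟦twist⟧ g e)) (sym (φ-* _ _))

    twist-coeffs : (∀ {x} → x ∈ C → φ x ∈ C) →
      ∀ {k} {f : Poly k} → CoeffsIn C f → CoeffsIn C (twist f)
    twist-coeffs φC (const a∈C) = const (φC a∈C)
    twist-coeffs φC var = var
    twist-coeffs φC (f∈C[X] ⊕ g∈C[X]) = twist-coeffs φC f∈C[X] ⊕ twist-coeffs φC g∈C[X]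
    twist-coeffs φC (f∈C[X] ⊗ g∈C[X]) = twist-coeffs φC f∈C[X] ⊗ twist-coeffs φC g∈C[X]

    locus-reflect : (∀ {x} → x ∈ C → φ x ∈ C) → (∀ x → φ x ≈ 0# → x ≈ 0#) →
      ∀ {k} {e e' : Vector Carrier k} → InLocus (φ ∘ e') (φ ∘ e) C → InLocus e' e C
    locus-reflect φC φ-reflects-0 {e = e} {e'} φe'∈locus f f∈C[X] fe≈0 =
      φ-reflects-0 (⟦ f ⟧ e') (begin
        φ (⟦ f ⟧ e')           ≈⟨ ⟦twist⟧ f e' ⟨
        ⟦ twist f ⟧ (φ ∘ e')   ≈⟨ φe'∈locus (twist f) (twist-coeffs φC f∈C[X]) twist-f-root ⟩
        0#                     ∎)
      where
      twist-f-root : ⟦ twist f ⟧ (φ ∘ e) ≈ 0#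
      twist-f-root = trans (⟦twist⟧ f e) (trans (φ-cong fe≈0) φ-0)

module FieldFrobenius {c ℓ} (K : Field c ℓ) {p : ℕ} (charExp : FieldOps.IsCharExp K p) where
  open Field K
  open FieldOps K hiding (_∷_; [])
  open import Algebra.Properties.Semiring.Exp semiring using (_^_; ^-congˡ)
  open import Algebra.Properties.Semiring.Mult semiring using (_×_)
  open import Algebra.Properties.CommutativeSemiring.Exp commutativeSemiring using (^-distrib-*)
  open import Data.Product using (_,_)
  open import Data.Sum using (inj₁; inj₂)
  import Relation.Binary.PropositionalEquality as ≡
  open import Relation.Binary.Reasoning.Setoid setoid
  open Frobenius commutativeRing using (frobenius)

  pow≈^ : ∀ x n → pow x n ≈ x ^ n
  pow≈^ x ℕ.zero  = refl
  pow≈^ x (suc n) = *-congˡ (pow≈^ x n)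

  natMul≈× : ∀ n x → natMul n x ≈ n × x
  natMul≈× ℕ.zero  x = refl
  natMul≈× (suc n) x = +-congˡ (natMul≈× n x)

  Fr : Carrier → Carrier
  Fr x = pow x p

  Fr-cong : ∀ {x y} → x ≈ y → Fr x ≈ Fr y
  Fr-cong {x} {y} x≈y = begin
    pow x p  ≈⟨ pow≈^ x p ⟩
    x ^ p    ≈⟨ ^-congˡ p x≈y ⟩
    y ^ p    ≈⟨ pow≈^ y p ⟨
    pow y p  ∎

  Fr-* : ∀ x y → Fr (x * y) ≈ Fr x * Fr y
  Fr-* x y = begin
    pow (x * y) p      ≈⟨ pow≈^ (x * y) p ⟩
    (x * y) ^ p        ≈⟨ ^-distrib-* x y p ⟩
    x ^ p * y ^ p      ≈⟨ *-cong (pow≈^ x p) (pow≈^ y p) ⟨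
    pow x p * pow y p  ∎

  Fr-+ : ∀ x y → Fr (x + y) ≈ Fr x + Fr y
  Fr-+ = additive charExp
    where
    additive : IsCharExp p → ∀ x y → Fr (x + y) ≈ Fr x + Fr y
    additive (inj₁ (≡.refl , _)) x y = begin
      (x + y) * 1#        ≈⟨ *-identityʳ _ ⟩
      x + y               ≈⟨ +-cong (*-identityʳ x) (*-identityʳ y) ⟨
      x * 1# + y * 1#     ∎
    additive (inj₂ (pp , p1≈0)) x y = begin
      pow (x + y) p       ≈⟨ pow≈^ (x + y) p ⟩
      (x + y) ^ p         ≈⟨ frobenius pp (trans (sym (natMul≈× p 1#)) p1≈0) x y ⟩
      x ^ p + y ^ p       ≈⟨ +-cong (pow≈^ x p) (pow≈^ y p) ⟨
      pow x p + pow y p   ∎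

-- In a valued field equality with zero is decidable, so a power vanishes
-- only at zero.
module ValuedField {c ℓ γ} (K : Field c ℓ) (val : Valuation K γ) where
  open Field K
  open FieldOps K hiding (_∷_; [])
  open Valuation val using (v; v-∞)
  open import Data.Maybe using (just; nothing)
  open import Data.Product using (_,_; proj₁; proj₂)
  open import Relation.Nullary using (¬_; Dec; yes; no; contradiction)
  import Relation.Binary.PropositionalEquality as ≡
  open import Relation.Binary.Reasoning.Setoid setoid

  ≈0? : ∀ x → Dec (x ≈ 0#)
  ≈0? x with v x in v-x
  ... | nothing = yes (proj₁ (v-∞ x) v-x)
  ... | just _  = no λ x≈0 → contradiction (≡.trans (≡.sym v-x) (proj₂ (v-∞ x) x≈0)) λ ()

  nonzero-* : ∀ {x y} → ¬ x ≈ 0# → ¬ y ≈ 0# → ¬ (x * y) ≈ 0#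
  nonzero-* {x} {y} x≉0 y≉0 xy≈0 with inverse x x≉0
  ... | x⁻¹ , xx⁻¹≈1 = y≉0 (begin
    y                ≈⟨ *-identityˡ y ⟨
    1# * y           ≈⟨ *-congʳ xx⁻¹≈1 ⟨
    (x * x⁻¹) * y    ≈⟨ *-congʳ (*-comm x x⁻¹) ⟩
    (x⁻¹ * x) * y    ≈⟨ *-assoc x⁻¹ x y ⟩
    x⁻¹ * (x * y)    ≈⟨ *-congˡ xy≈0 ⟩
    x⁻¹ * 0#         ≈⟨ zeroʳ x⁻¹ ⟩
    0#               ∎)

  nonzero-pow : ∀ {x} m → ¬ x ≈ 0# → ¬ pow x m ≈ 0#
  nonzero-pow ℕ.zero  x≉0 = 1≉0
  nonzero-pow (suc m) x≉0 = nonzero-* x≉0 (nonzero-pow m x≉0)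

  pow-reflects-0 : ∀ m x → pow x m ≈ 0# → x ≈ 0#
  pow-reflects-0 m x xᵐ≈0 with ≈0? x
  ... | yes x≈0 = x≈0
  ... | no  x≉0 = contradiction xᵐ≈0 (nonzero-pow m x≉0)

module PowerMaps {c ℓ} (K : Field c ℓ) {C : Pred (Field.Carrier K) ℓ}
                 (sub : FieldOps.IsSubfield K C) (p n : ℕ) where
  open Field K hiding (zero)
  open FieldOps K hiding (_∷_; [])
  open IsSubfield sub using (1∈; *-cl)
  open Loci K C
  open import Data.Fin using (zero; suc)
  open import Relation.Unary using (_∈_)

  pow-closed : ∀ {x} m → x ∈ C → pow x m ∈ C
  pow-closed ℕ.zero  x∈C = 1∈
  pow-closed (suc m) x∈C = *-cl x∈C (pow-closed m x∈C)

  power-first : PolyMap (suc n) (suc n)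
  power-first = powP (var zero) p ∷ λ i → var (suc i)

  power-rest : PolyMap (suc n) (suc n)
  power-rest = var zero ∷ λ i → powP (var (suc i)) p

  power-first-coeffs : ∀ i → CoeffsIn C (power-first i)
  power-first-coeffs zero    = powP-coeffs 1∈ p var
  power-first-coeffs (suc i) = var

  power-rest-coeffs : ∀ i → CoeffsIn C (power-rest i)
  power-rest-coeffs zero    = var
  power-rest-coeffs (suc i) = powP-coeffs 1∈ p var

  apply-power-first : ∀ x y i → apply power-first (x ∷ y) i ≈ (pow x p ∷ y) i
  apply-power-first x y zero    = ⟦powP⟧ (var zero) p (x ∷ y)
  apply-power-first x y (suc i) = refl

  apply-power-rest : ∀ x y i → apply power-rest (pow x p ∷ y) i ≈ pow ((x ∷ y) i) p
  apply-power-rest x y zero    = refl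
  apply-power-rest x y (suc i) = ⟦powP⟧ (var (suc i)) p (pow x p ∷ y)

open import Function using (_∘_; mk⇔)

lemma4p12 : ∀ {c ℓ γ} (K : Field c ℓ) (val : Valuation K γ) →
    ValuationProps.Henselian val → ValuationProps.Nontrivial val →
    (p : ℕ) → FieldOps.IsCharExp K p →
    (C : Pred (Field.Carrier K) ℓ) → FieldOps.IsSubfield K C →
    FieldOps.Separable K p C →
    (n : ℕ) (a : Field.Carrier K) (b : Vector (Field.Carrier K) n)
    (c : Field.Carrier K) (d : Vector (Field.Carrier K) n) →
    FieldOps.InLocus K (c ∷ d) (a ∷ b) C
    ⇔ FieldOps.InLocus K (FieldOps.pow K c p ∷ d) (FieldOps.pow K a p ∷ b) C
lemma4p12 K val _ _ p charExp C sub _ n a b c d = mk⇔ forward backward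
  where
  open Loci K C
  open PowerMaps K sub p n
  open FieldFrobenius K charExp using (Fr; Fr-cong; Fr-+; Fr-*)
  open Twist Fr Fr-cong Fr-+ Fr-* using (locus-reflect)
  open ValuedField K val using (pow-reflects-0)

  forward : FieldOps.InLocus K (c ∷ d) (a ∷ b) C →
            FieldOps.InLocus K (FieldOps.pow K c p ∷ d) (FieldOps.pow K a p ∷ b) C
  forward = InLocus-resp (apply-power-first a b) (apply-power-first c d)
          ∘ locus-map power-first power-first-coeffs

  backward : FieldOps.InLocus K (FieldOps.pow K c p ∷ d) (FieldOps.pow K a p ∷ b) C →
             FieldOps.InLocus K (c ∷ d) (a ∷ b) C
  backward = locus-reflect (pow-closed p) (pow-reflects-0 p)
           ∘ InLocus-resp (apply-power-rest a b) (apply-power-rest c d)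
           ∘ locus-map power-rest power-rest-coeffs
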